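{- Let $p,q\geq 3$ be distinct primes, $\alpha,\beta\geq 1$ integers, and $\Gamma=\mathrm{Cay}(\mathbb{Z}_{p}\times\mathbb{Z}_{p^{\alpha}q^{\beta}},\Phi)$ with $\Phi=\varphi_p\times\varphi_{p^{\alpha}q^{\beta}}$. Then $\mathrm{diam}(\Gamma)=2$.
   Context: For $n\geq 1$, $\mathbb{Z}_n=\{0,\dots,n-1\}$ is the integers mod $n$ and $\varphi_n$ is the set of elements of $\mathbb{Z}_n$ coprime to $n$ ($\varphi_p=\mathbb{Z}_p\setminus\{0\}$). $\mathrm{Cay}(\mathbb{Z}_p\times\mathbb{Z}_m,\varphi_p\times\varphi_m)$ is the graph on $\mathbb{Z}_p\times\mathbb{Z}_m$ where $(u,v)\sim(u',v')$ iff $u-u'\in\varphi_p$ and $v-v'\in\varphi_m$. -}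

module Defs where

open import Data.Nat using (ℕ; zero; suc; _+_; _∸_; _<_; _≤_)
open import Data.Nat.DivMod using (_%_)
open import Data.Nat.Coprimality using (Coprime)
open import Data.Fin using (Fin; toℕ)
open import Data.Product using (_×_; Σ; ∃; ∃-syntax; _,_)
open import Relation.Nullary using (¬_)

-- (a - b) mod n, for a b < n  (n = 0 never arises for the moduli used)
diffMod : ℕ → ℕ → ℕ → ℕ
diffMod zero    _ _ = 0
diffMod (suc k) a b = (a + (suc k ∸ b)) % suc k

InPhi : (n : ℕ) → ℕ → Set
InPhi n x = Coprime x n

Vertex : ℕ → ℕ → Set
Vertex n m = Fin n × Fin m

CayAdj : (n m : ℕ) → Vertex n m → Vertex n m → Set
CayAdj n m (u , v) (u' , v') =
  InPhi n (diffMod n (toℕ u) (toℕ u')) × InPhi m (diffMod m (toℕ v) (toℕ v'))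

data Walk {V : Set} (E : V → V → Set) : V → V → ℕ → Set where
  here  : ∀ {x} → Walk E x x 0
  step  : ∀ {x y z k} → E x y → Walk E y z k → Walk E x z (suc k)

IsDist : {V : Set} (E : V → V → Set) → V → V → ℕ → Set
IsDist E x y d = Walk E x y d × (∀ k → k < d → ¬ Walk E x y k)

HasDiameter : {V : Set} (E : V → V → Set) → ℕ → Set
HasDiameter {V} E d =
  (∀ (x y : V) → ∃[ k ] (k ≤ d × Walk E x y k)) × (∃[ x ] ∃[ y ] IsDist E x y d)

-- A common neighbour of (a, b) and (c, d) is (a - t, b - u) as soon as t and (a - c) - t are
-- prime to p and u and (b - d) - u are prime to both p and q (coprimality to p^α q^β only sees
-- p and q). Some t ∈ {1, 2} works since p cannot divide both a - c - 1 and a - c - 2. For u,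
-- try ±1, ±2: comparing only candidates that differ by 1, 2 or 3, a modulus ≥ 3 can block two
-- of them only if it is 3, so the distinct p and q cannot block all four. Finally (0, 0) and
-- (0, 1) are distinct and non-adjacent, as their first coordinates coincide.
module Submission where

open import Defs
open import Data.Nat using (ℕ; _≤_; _*_; _^_)
open import Relation.Binary.PropositionalEquality using (_≢_)
open import Data.Nat.Primality using (Prime)

open import Data.Nat as ℕ using (zero; suc; _<_; _∸_; z≤n; s≤s; z<s; s<s; NonZero; NonTrivial)
import Data.Nat.Properties as ℕ
open import Data.Nat.DivMod using (_%_; n%n≡0)
open import Data.Nat.Divisibility as ℕ∣ using () renaming (_∣_ to _∣ℕ_)
open import Data.Nat.Coprimality as Coprime using (Coprime; coprime-divisor; 1-coprimeTo; ¬0-coprimeTo-2+)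
open import Data.Nat.Primality using (prime⇒irreducible; prime⇒nonZero; prime⇒nonTrivial)
open import Data.Integer as ℤ using (ℤ; +_; -[1+_]; 1ℤ; -1ℤ; ∣_∣; _+_; _-_; -_; _%ℕ_; _/ℕ_)
open import Data.Integer.DivMod using (n%ℕd<d; a≡a%ℕn+[a/ℕn]*n)
import Data.Integer.Properties as ℤ
open import Data.Integer.Divisibility.Signed
open import Data.Integer.Tactic.RingSolver using (solve-∀)
open import Data.Fin using (Fin; toℕ; fromℕ<)
open import Data.Fin.Properties using (toℕ<n; toℕ-fromℕ<; fromℕ<-injective)
open import Data.Product using (_×_; _,_; proj₂; ∃)
open import Data.Sum using (inj₁; inj₂)
open import Relation.Nullary using (¬_; yes; no; contradiction)
open import Relation.Binary.PropositionalEquality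
  using (_≡_; refl; sym; trans; cong; subst; ≢-sym; module ≡-Reasoning)

infix 4 _≡_[mod_]
record _≡_[mod_] (x y : ℤ) (n : ℕ) : Set where
  constructor congruent
  field ∣-difference : + n ∣ x - y

open _≡_[mod_]

%ℕ-≡[mod] : ∀ i n .{{_ : NonZero n}} → + (i %ℕ n) ≡ i [mod n ]
%ℕ-≡[mod] i n = congruent (divides (- (i /ℕ n)) (begin
  + (i %ℕ n) - i                                ≡⟨ cong (λ j → + (i %ℕ n) - j) (a≡a%ℕn+[a/ℕn]*n i n) ⟩
  + (i %ℕ n) - (+ (i %ℕ n) + (i /ℕ n) ℤ.* + n)  ≡⟨ cancel (+ (i %ℕ n)) (i /ℕ n) (+ n) ⟩
  - (i /ℕ n) ℤ.* + n                            ∎))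
  where
  open ≡-Reasoning
  cancel : ∀ r q n → r - (r + q ℤ.* n) ≡ - q ℤ.* n
  cancel = solve-∀

≡[mod]-trans : ∀ {x y z n} → x ≡ y [mod n ] → y ≡ z [mod n ] → x ≡ z [mod n ]
≡[mod]-trans {x} {y} {z} (congruent x≡y) (congruent y≡z) =
  congruent (subst (_ ∣_) (telescope x y z) (∣m∣n⇒∣m+n x≡y y≡z))
  where
  telescope : ∀ x y z → (x - y) + (y - z) ≡ x - z
  telescope = solve-∀

≡[mod]-weaken : ∀ {x y n r} → r ∣ℕ n → x ≡ y [mod n ] → x ≡ y [mod r ]
≡[mod]-weaken r∣n (congruent n∣x-y) = congruent (∣-trans (∣ᵤ⇒∣ r∣n) n∣x-y)

≡[mod]-∤ : ∀ {x : ℕ} {y r} → + x ≡ y [mod r ] → ¬ (+ r ∣ y) → ¬ (r ∣ℕ x)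
≡[mod]-∤ {x} {y} (congruent x≡y) r∤y r∣x =
  r∤y (subst (_ ∣_) (cancel (+ x) y) (∣m∣n⇒∣m-n (∣ᵤ⇒∣ {i = + x} r∣x) x≡y))
  where
  cancel : ∀ x y → x - (x - y) ≡ y
  cancel = solve-∀

diffMod-≡[mod] : ∀ n a b .{{_ : NonZero n}} → b ≤ n → + diffMod n a b ≡ + a - + b [mod n ]
diffMod-≡[mod] n@(suc _) a b b≤n =
  ≡[mod]-trans (%ℕ-≡[mod] (+ (a ℕ.+ (n ∸ b))) n) (congruent (∣-reflexive (sym wrap)))
  where
  open ≡-Reasoning
  rearrange : ∀ a n b → (a + (n - b)) - (a - b) ≡ n
  rearrange = solve-∀
  wrap : + (a ℕ.+ (n ∸ b)) - (+ a - + b) ≡ + n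
  wrap = begin
    + (a ℕ.+ (n ∸ b)) - (+ a - + b)    ≡⟨ cong (_- (+ a - + b)) (ℤ.pos-+ a (n ∸ b)) ⟩
    (+ a + + (n ∸ b)) - (+ a - + b)    ≡⟨ cong (λ j → (+ a + j) - (+ a - + b)) (sym (ℤ.⊖-≥ b≤n)) ⟩
    (+ a + (n ℤ.⊖ b)) - (+ a - + b)    ≡⟨ cong (λ j → (+ a + j) - (+ a - + b)) (sym (ℤ.m-n≡m⊖n n b)) ⟩
    (+ a + (+ n - + b)) - (+ a - + b)  ≡⟨ rearrange (+ a) (+ n) (+ b) ⟩
    + n                                ∎

module _ {n : ℕ} .{{_ : NonZero n}} where

  shift : Fin n → ℤ → Fin n
  shift a t = fromℕ< (n%ℕd<d (+ toℕ a - t) n)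

  shift-≡[mod] : ∀ a t → + toℕ (shift a t) ≡ + toℕ a - t [mod n ]
  shift-≡[mod] a t rewrite toℕ-fromℕ< (n%ℕd<d (+ toℕ a - t) n) = %ℕ-≡[mod] (+ toℕ a - t) n

  diffMod-toℕ-≡[mod] : ∀ (a b : Fin n) → + diffMod n (toℕ a) (toℕ b) ≡ + toℕ a - + toℕ b [mod n ]
  diffMod-toℕ-≡[mod] a b = diffMod-≡[mod] n (toℕ a) (toℕ b) (ℕ.<⇒≤ (toℕ<n b))

  diffMod-shiftˡ : ∀ a t → + diffMod n (toℕ a) (toℕ (shift a t)) ≡ t [mod n ]
  diffMod-shiftˡ a t = ≡[mod]-trans (diffMod-toℕ-≡[mod] a (shift a t))
    (congruent (subst (_ ∣_) (flip (+ toℕ (shift a t)) (+ toℕ a) t)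
                             (∣m⇒∣-m (∣-difference (shift-≡[mod] a t)))))
    where
    flip : ∀ w a t → - (w - (a - t)) ≡ (a - w) - t
    flip = solve-∀

  diffMod-shiftʳ : ∀ a c t → + diffMod n (toℕ (shift a t)) (toℕ c) ≡ (+ toℕ a - + toℕ c) - t [mod n ]
  diffMod-shiftʳ a c t = ≡[mod]-trans (diffMod-toℕ-≡[mod] (shift a t) c)
    (congruent (subst (_ ∣_) (shuffle (+ toℕ (shift a t)) (+ toℕ a) (+ toℕ c) t)
                             (∣-difference (shift-≡[mod] a t))))
    where
    shuffle : ∀ w a c t → w - (a - t) ≡ (w - c) - ((a - c) - t)
    shuffle = solve-∀

∣⇒≤∣∣ : ∀ {r z} → 0 < ∣ z ∣ → + r ∣ z → r ≤ ∣ z ∣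
∣⇒≤∣∣ {z = z} 0<∣z∣ r∣z = ℕ∣.∣⇒≤ {{ℕ.>-nonZero 0<∣z∣}} (∣⇒∣ᵤ r∣z)

<∣∣⇒∤ : ∀ {r z} → 0 < ∣ z ∣ → ∣ z ∣ < r → ¬ (+ r ∣ z)
<∣∣⇒∤ 0<∣z∣ ∣z∣<r r∣z = ℕ.<⇒≱ ∣z∣<r (∣⇒≤∣∣ 0<∣z∣ r∣z)

∣m-i∧∣m-j⇒∣j-i : ∀ {r} m i j → r ∣ m - i → r ∣ m - j → r ∣ j - i
∣m-i∧∣m-j⇒∣j-i m i j r∣m-i r∣m-j = subst (_ ∣_) (cancel m i j) (∣m∣n⇒∣m-n r∣m-i r∣m-j)
  where
  cancel : ∀ m i j → (m - i) - (m - j) ≡ j - i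
  cancel = solve-∀

Splits : ℕ → ℤ → ℤ → Set
Splits r D t = ¬ (+ r ∣ t) × ¬ (+ r ∣ D - t)

module _ {r : ℕ} (3≤r : 3 ≤ r) where

  ∤±1 : ∀ {z} → ∣ z ∣ ≡ 1 → ¬ (+ r ∣ z)
  ∤±1 ∣z∣≡1 = <∣∣⇒∤ (subst (0 <_) (sym ∣z∣≡1) z<s) (subst (_< r) (sym ∣z∣≡1) (ℕ.<-≤-trans (s<s z<s) 3≤r))

  ∤±2 : ∀ {z} → ∣ z ∣ ≡ 2 → ¬ (+ r ∣ z)
  ∤±2 ∣z∣≡2 = <∣∣⇒∤ (subst (0 <_) (sym ∣z∣≡2) z<s) (subst (_< r) (sym ∣z∣≡2) 3≤r)

  ∣±3⇒≡3 : ∀ {z} → ∣ z ∣ ≡ 3 → + r ∣ z → r ≡ 3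
  ∣±3⇒≡3 ∣z∣≡3 r∣z = ℕ.≤-antisym (subst (r ≤_) ∣z∣≡3 (∣⇒≤∣∣ (subst (0 <_) (sym ∣z∣≡3) z<s) r∣z)) 3≤r

  splits-one : ∀ D → ∃ (Splits r D)
  splits-one D with + r ∣? D - 1ℤ
  ... | no r∤D-1 = 1ℤ , ∤±1 refl , r∤D-1
  ... | yes r∣D-1 = + 2 , ∤±2 refl , λ r∣D-2 → ∤±1 refl (∣m-i∧∣m-j⇒∣j-i D 1ℤ (+ 2) r∣D-1 r∣D-2)

splits-both-given-∣D-1 : ∀ {r s} → 3 ≤ r → 3 ≤ s → r ≢ s → ∀ D → + r ∣ D - 1ℤ →
                         ∃ λ t → Splits r D t × Splits s D t
splits-both-given-∣D-1 {r} {s} 3≤r 3≤s r≢s D r∣D-1 with + s ∣? D - -1ℤ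
... | no s∤D+1 = -1ℤ , (∤±1 3≤r refl , r∤D+1) , (∤±1 3≤s refl , s∤D+1)
  where
  r∤D+1 : ¬ (+ r ∣ D - -1ℤ)
  r∤D+1 r∣D+1 = ∤±2 3≤r refl (∣m-i∧∣m-j⇒∣j-i D 1ℤ -1ℤ r∣D-1 r∣D+1)
... | yes s∣D+1 with + s ∣? D - + 2
...   | no s∤D-2 = + 2 , (∤±2 3≤r refl , r∤D-2) , (∤±2 3≤s refl , s∤D-2)
  where
  r∤D-2 : ¬ (+ r ∣ D - + 2)
  r∤D-2 r∣D-2 = ∤±1 3≤r refl (∣m-i∧∣m-j⇒∣j-i D 1ℤ (+ 2) r∣D-1 r∣D-2)
...   | yes s∣D-2 = -[1+ 1 ] , (∤±2 3≤r refl , r∤D+2) , (∤±2 3≤s refl , s∤D+2)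
  where
  s≡3 : s ≡ 3
  s≡3 = ∣±3⇒≡3 3≤s refl (∣m-i∧∣m-j⇒∣j-i D -1ℤ (+ 2) s∣D+1 s∣D-2)
  r∤D+2 : ¬ (+ r ∣ D - -[1+ 1 ])
  r∤D+2 r∣D+2 = r≢s (trans (∣±3⇒≡3 3≤r refl (∣m-i∧∣m-j⇒∣j-i D 1ℤ -[1+ 1 ] r∣D-1 r∣D+2)) (sym s≡3))
  s∤D+2 : ¬ (+ s ∣ D - -[1+ 1 ])
  s∤D+2 s∣D+2 = ∤±1 3≤s refl (∣m-i∧∣m-j⇒∣j-i D -1ℤ -[1+ 1 ] s∣D+1 s∣D+2)

splits-both : ∀ {r s} → 3 ≤ r → 3 ≤ s → r ≢ s → ∀ D → ∃ λ t → Splits r D t × Splits s D t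
splits-both {r} {s} 3≤r 3≤s r≢s D with + r ∣? D - 1ℤ | + s ∣? D - 1ℤ
... | no r∤D-1 | no s∤D-1 = 1ℤ , (∤±1 3≤r refl , r∤D-1) , (∤±1 3≤s refl , s∤D-1)
... | yes r∣D-1 | _ = splits-both-given-∣D-1 3≤r 3≤s r≢s D r∣D-1
... | no _ | yes s∣D-1 with splits-both-given-∣D-1 3≤s 3≤r (≢-sym r≢s) D s∣D-1
...   | t , splits-s , splits-r = t , splits-r , splits-s

prime∤⇒coprime : ∀ {p x} → Prime p → ¬ (p ∣ℕ x) → Coprime x p
prime∤⇒coprime p-prime p∤x (d∣x , d∣p) with prime⇒irreducible p-prime d∣p
... | inj₁ d≡1 = d≡1
... | inj₂ refl = contradiction d∣x p∤x

coprime-* : ∀ {x a b} → Coprime x a → Coprime x b → Coprime x (a * b)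
coprime-* {x} {a} x⊥a x⊥b (d∣x , d∣ab) = x⊥b (d∣x , coprime-divisor d⊥a d∣ab)
  where
  d⊥a : Coprime _ a
  d⊥a (e∣d , e∣a) = x⊥a (ℕ∣.∣-trans e∣d d∣x , e∣a)

coprime-^ : ∀ {x a} k → Coprime x a → Coprime x (a ^ k)
coprime-^ zero    x⊥a = Coprime.sym (1-coprimeTo _)
coprime-^ (suc k) x⊥a = coprime-* x⊥a (coprime-^ k x⊥a)

coprime-^*^ : ∀ {p q x} α β → Prime p → Prime q → ¬ (p ∣ℕ x) → ¬ (q ∣ℕ x) → Coprime x (p ^ α * q ^ β)
coprime-^*^ α β p-prime q-prime p∤x q∤x =
  coprime-* (coprime-^ α (prime∤⇒coprime p-prime p∤x)) (coprime-^ β (prime∤⇒coprime q-prime q∤x))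

m∣m^n : ∀ {m n} → 1 ≤ n → m ∣ℕ m ^ n
m∣m^n {m} {suc n} _ = ℕ∣.m∣m*n (m ^ n)

diffMod-self : ∀ n a .{{_ : NonZero n}} → a ≤ n → diffMod n a a ≡ 0
diffMod-self n@(suc _) a a≤n = trans (cong (_% n) (ℕ.m+[n∸m]≡n a≤n)) (n%n≡0 n)

walk-length-0 : ∀ {V : Set} {E : V → V → Set} {x y} → Walk E x y 0 → x ≡ y
walk-length-0 here = refl

walk-length-1 : ∀ {V : Set} {E : V → V → Set} {x y} → Walk E x y 1 → E x y
walk-length-1 (step e here) = e

diameter-two : ∀ {V : Set} {E : V → V → Set} → (∀ x y → ∃ λ z → E x z × E z y) →
               (∃ λ x → ∃ λ y → x ≢ y × ¬ E x y) → HasDiameter E 2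
diameter-two {E = E} common (x , y , x≢y , x≁y) =
  (λ u v → 2 , ℕ.≤-refl , walk₂ u v) , x , y , walk₂ x y , no-shorter
  where
  walk₂ : ∀ u v → Walk E u v 2
  walk₂ u v with common u v
  ... | _ , u∼z , z∼v = step u∼z (step z∼v here)
  no-shorter : ∀ k → k < 2 → ¬ Walk E x y k
  no-shorter zero          _ w = x≢y (walk-length-0 w)
  no-shorter (suc zero)    _ w = x≁y (walk-length-1 w)
  no-shorter (suc (suc _)) (s<s (s<s ()))

nonadjacent-pair : ∀ {n m} .{{_ : NonTrivial n}} → 1 < m → ∃ λ x → ∃ λ y → x ≢ y × ¬ CayAdj n m x y
nonadjacent-pair {n} {m} 1<m = (a , b) , (a , b′) , ab≢ab′ , ab≁ab′
  where
  a : Fin n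
  a = fromℕ< (ℕ.<-trans z<s (ℕ.nonTrivial⇒n>1 n))
  b b′ : Fin m
  b  = fromℕ< (ℕ.<-trans z<s 1<m)
  b′ = fromℕ< 1<m
  ab≢ab′ : (a , b) ≢ (a , b′)
  ab≢ab′ eq = ℕ.0≢1+n (fromℕ<-injective 0 1 _ _ (cong proj₂ eq))
  ab≁ab′ : ¬ CayAdj n m (a , b) (a , b′)
  ab≁ab′ (a-a⊥n , _) = ¬0-coprimeTo-2+ {n} (subst (λ x → Coprime x n) a-a≡0 a-a⊥n)
    where
    a-a≡0 : diffMod n (toℕ a) (toℕ a) ≡ 0
    a-a≡0 = diffMod-self n (toℕ a) {{ℕ.nonTrivial⇒nonZero n}} (ℕ.<⇒≤ (toℕ<n a))

module _ {n m r s : ℕ} {{_ : NonZero n}} {{_ : NonZero m}} (n-prime : Prime n) (3≤n : 3 ≤ n)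
         (3≤r : 3 ≤ r) (3≤s : 3 ≤ s) (r≢s : r ≢ s) (r∣m : r ∣ℕ m) (s∣m : s ∣ℕ m)
         (coprime-m : ∀ {x} → ¬ (r ∣ℕ x) → ¬ (s ∣ℕ x) → Coprime x m) where

  common-neighbour : ∀ x y → ∃ λ z → CayAdj n m x z × CayAdj n m z y
  common-neighbour (a , b) (c , d)
    with splits-one 3≤n (+ toℕ a - + toℕ c) | splits-both 3≤r 3≤s r≢s (+ toℕ b - + toℕ d)
  ... | t , n∤t , n∤[a-c]-t | u , (r∤u , r∤[b-d]-u) , (s∤u , s∤[b-d]-u) =
    (shift a t , shift b u) ,
    (prime-to-n (diffMod-shiftˡ a t) n∤t , prime-to-m (diffMod-shiftˡ b u) r∤u s∤u) ,
    (prime-to-n (diffMod-shiftʳ a c t) n∤[a-c]-t , prime-to-m (diffMod-shiftʳ b d u) r∤[b-d]-u s∤[b-d]-u)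
    where
    prime-to-n : ∀ {x i} → + x ≡ i [mod n ] → ¬ (+ n ∣ i) → Coprime x n
    prime-to-n x≡i n∤i = prime∤⇒coprime n-prime (≡[mod]-∤ x≡i n∤i)
    prime-to-m : ∀ {x i} → + x ≡ i [mod m ] → ¬ (+ r ∣ i) → ¬ (+ s ∣ i) → Coprime x m
    prime-to-m x≡i r∤i s∤i =
      coprime-m (≡[mod]-∤ (≡[mod]-weaken r∣m x≡i) r∤i) (≡[mod]-∤ (≡[mod]-weaken s∣m x≡i) s∤i)

proposition3p5 : (p q α β : ℕ) → Prime p → Prime q → 3 ≤ p → 3 ≤ q → p ≢ q →
    1 ≤ α → 1 ≤ β →
    HasDiameter (CayAdj p (p ^ α * q ^ β)) 2
proposition3p5 p q α β p-prime q-prime 3≤p 3≤q p≢q 1≤α 1≤β =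
  diameter-two (common-neighbour p-prime 3≤p 3≤p 3≤q p≢q p∣m q∣m (coprime-^*^ α β p-prime q-prime))
               (nonadjacent-pair 1<m)
  where
  instance
    p-nonTrivial : NonTrivial p
    p-nonTrivial = prime⇒nonTrivial p-prime
    p-nonZero : NonZero p
    p-nonZero = prime⇒nonZero p-prime
    q-nonZero : NonZero q
    q-nonZero = prime⇒nonZero q-prime
  m : ℕ
  m = p ^ α * q ^ β
  instance
    m-nonZero : NonZero m
    m-nonZero = ℕ.m*n≢0 (p ^ α) (q ^ β) {{ℕ.m^n≢0 p α}} {{ℕ.m^n≢0 q β}}
  p∣m : p ∣ℕ m
  p∣m = ℕ∣.∣m⇒∣m*n (q ^ β) (m∣m^n 1≤α)
  q∣m : q ∣ℕ m
  q∣m = ℕ∣.∣-trans (m∣m^n 1≤β) (ℕ∣.n∣m*n (p ^ α))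
  1<m : 1 < m
  1<m = ℕ.≤-trans (s≤s (s≤s z≤n)) (ℕ.≤-trans 3≤p (ℕ∣.∣⇒≤ p∣m))
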